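{- Let $F:\mathbf{Sets}\to\mathbf{Sets}$ be a functor and $\sqsubseteq$ an order on $F$. Then $F$ with $\sqsubseteq$ is stable if and only if $F$ with the opposite order $\sqsubseteq^{op}$ (given by $u\sqsubseteq^{op}_X v$ iff $v\sqsubseteq_X u$) is stable.
   Context: An order on $F$ is a family of preorders $\sqsubseteq_X\subseteq FX\times FX$, one for each set $X$, such that for every $f:X\to Y$, $u\sqsubseteq_X u'$ implies $Ff(u)\sqsubseteq_Y Ff(u')$. For a relation $R\subseteq X_1\times X_2$ with projections $r_1,r_2$, $\mathrm{Rel}(F)(R)=\{(u,v)\in FX_1\times FX_2\mid\exists w\in F(R).\,Fr_1(w)=u,\ Fr_2(w)=v\}$, and the lax relation lifting is $\mathrm{Rel}_{\sqsubseteq}(F)(R)=\{(u,v)\mid\exists w\in F(R).\,u\sqsubseteq_{X_1}Fr_1(w)\wedge Fr_2(w)\sqsubseteq_{X_2}v\}$. $F$ with $\sqsubseteq$ is stable if for all functions $f:X\to Z$, $g:Y\to W$ and all relations $R\subseteq Z\times W$: $\mathrm{Rel}_{\sqsubseteq}(F)((f\times g)^{ -1}(R))=(Ff\times Fg)^{ -1}(\mathrm{Rel}_{\sqsubseteq}(F)(R))$, where $(f\times g)^{ -1}(R)=\{(x,y)\mid (f(x),g(y))\in R\}$. -}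

module Defs where

open import Data.Product using (Σ; Σ-syntax; _×_; _,_; proj₁; proj₂; ∃; ∃-syntax)
open import Relation.Binary.PropositionalEquality using (_≡_)
open import Function using (id; _∘_)

record Functor : Set₁ where
  field
    F       : Set → Set
    fmap    : {X Y : Set} → (X → Y) → F X → F Y
    fmap-id : {X : Set} (u : F X) → fmap id u ≡ u
    fmap-∘  : {X Y Z : Set} (g : Y → Z) (f : X → Y) (u : F X) →
              fmap (g ∘ f) u ≡ fmap g (fmap f u)
open Functor public

Rel : Set → Set → Set₁
Rel X₁ X₂ = X₁ → X₂ → Set

record Order (Fn : Functor) : Set₁ where
  field
    _⊑_       : {X : Set} → F Fn X → F Fn X → Set
    ⊑-refl    : {X : Set} (u : F Fn X) → u ⊑ u
    ⊑-trans   : {X : Set} {u v w : F Fn X} → u ⊑ v → v ⊑ w → u ⊑ w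
    ⊑-mono    : {X Y : Set} (f : X → Y) {u u' : F Fn X} →
                u ⊑ u' → fmap Fn f u ⊑ fmap Fn f u'
open Order public

opOrder : {Fn : Functor} → Order Fn → Order Fn
opOrder o = record
  { _⊑_     = λ u v → _⊑_ o v u
  ; ⊑-refl  = ⊑-refl o
  ; ⊑-trans = λ p q → ⊑-trans o q p
  ; ⊑-mono  = λ f p → ⊑-mono o f p
  }

Graph : {X₁ X₂ : Set} → Rel X₁ X₂ → Set
Graph {X₁} {X₂} R = Σ[ x ∈ X₁ ] Σ[ y ∈ X₂ ] R x y

r₁ : {X₁ X₂ : Set} {R : Rel X₁ X₂} → Graph R → X₁
r₁ (x , _ , _) = x

r₂ : {X₁ X₂ : Set} {R : Rel X₁ X₂} → Graph R → X₂
r₂ (_ , y , _) = y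

RelLax : (Fn : Functor) → Order Fn → {X₁ X₂ : Set} → Rel X₁ X₂ →
         Rel (F Fn X₁) (F Fn X₂)
RelLax Fn o {X₁} {X₂} R u v =
  Σ[ w ∈ F Fn (Graph R) ]
    (_⊑_ o u (fmap Fn (r₁ {R = R}) w) × _⊑_ o (fmap Fn (r₂ {R = R}) w) v)

preimage : {X Y Z W : Set} → (X → Z) → (Y → W) → Rel Z W → Rel X Y
preimage f g R x y = R (f x) (g y)

_≐_ : {A B : Set} → Rel A B → Rel A B → Set
S ≐ T = (∀ a b → S a b → T a b) × (∀ a b → T a b → S a b)

Stable : (Fn : Functor) → Order Fn → Set₁
Stable Fn o = {X Y Z W : Set} (f : X → Z) (g : Y → W) (R : Rel Z W) →
  RelLax Fn o (preimage f g R)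
    ≐ preimage (fmap Fn f) (fmap Fn g) (RelLax Fn o R)

{-# OPTIONS --safe #-}
module Submission where

-- Transposing a relation swaps the two inequalities in the lax lifting, so
-- Rel_⊑(R) is the transpose of Rel_⊑ᵒᵖ(Rᵀ); as (f × g)⁻¹ commutes with
-- transposition, stability for ⊑ transfers to ⊑ᵒᵖ. The converse is the same
-- argument applied to ⊑ᵒᵖ, since (⊑ᵒᵖ)ᵒᵖ is ⊑ definitionally (record η).

open import Defs
open import Data.Product using (_×_; _,_; proj₁; proj₂)
open import Function using (flip; _∘_)
open import Relation.Binary.PropositionalEquality using (_≡_; subst)

module _ (Fn : Functor) where

  Graph-transpose : {A B : Set} {R : Rel A B} → Graph R → Graph (flip R)
  Graph-transpose (x , y , r) = y , x , r

  fmap-r₁-transpose : {A B : Set} {R : Rel A B} (w : F Fn (Graph R)) →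
    fmap Fn r₂ w ≡ fmap Fn r₁ (fmap Fn (Graph-transpose {R = R}) w)
  fmap-r₁-transpose {R = R} = fmap-∘ Fn r₁ (Graph-transpose {R = R})

  fmap-r₂-transpose : {A B : Set} {R : Rel A B} (w : F Fn (Graph R)) →
    fmap Fn r₁ w ≡ fmap Fn r₂ (fmap Fn (Graph-transpose {R = R}) w)
  fmap-r₂-transpose {R = R} = fmap-∘ Fn r₂ (Graph-transpose {R = R})

  RelLax-transpose : (o : Order Fn) {A B : Set} (R : Rel A B) {u : F Fn A} {v : F Fn B} →
    RelLax Fn o R u v → RelLax Fn (opOrder o) (flip R) v u
  RelLax-transpose o R {u} {v} (w , u⊑r₁w , r₂w⊑v) =
    fmap Fn Graph-transpose w ,
    subst (λ z → _⊑_ o z v) (fmap-r₁-transpose w) r₂w⊑v ,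
    subst (_⊑_ o u) (fmap-r₂-transpose w) u⊑r₁w

  Stable-op : (o : Order Fn) → Stable Fn o → Stable Fn (opOrder o)
  Stable-op o stable f g R =
    (λ u v → RelLax-transpose o (flip R) ∘ proj₁ (stable g f (flip R)) v u
                                         ∘ RelLax-transpose (opOrder o) (preimage f g R)) ,
    (λ u v → RelLax-transpose o (preimage g f (flip R)) ∘ proj₂ (stable g f (flip R)) v u
                                                        ∘ RelLax-transpose (opOrder o) R)

lemma2 : (Fn : Functor) (o : Order Fn) →
    (Stable Fn o → Stable Fn (opOrder o)) × (Stable Fn (opOrder o) → Stable Fn o)
lemma2 Fn o = Stable-op Fn o , Stable-op Fn (opOrder o)
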